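{- For $n>0$, let $\varkappa(n,1)$ and $\varkappa(n,2)$ be respectively the number of generators and the number of $2$-cells of the column presentation $\mathrm{Col}_2(n)$. Then $\varkappa(n,1)=2^n-1$ and $$\varkappa(n,2)=\varkappa(n,1)^2-\left(\prod_{1\le i\le j\le n}\frac{i+j+1}{i+j-1}-\prod_{1\le i\le j\le n}\frac{i+j}{i+j-1}\right).$$
   Context: Let $[n]=\{1<\dots<n\}$. A column is a word $x_p\dots x_1$ over $[n]$ with $x_p>\dots>x_1$; $\mathrm{col}(n)$ is the set of nonempty columns. For columns $u=x_p\dots x_1$ and $v=y_q\dots y_1$, say $(u,v)$ forms a tableau if $p\ge q$ and $x_i\le y_i$ for all $i\le q$. The column presentation $\mathrm{Col}_2(n)$ has one generator $c_u$ for each $u\in\mathrm{col}(n)$ and one $2$-cell $\alpha_{u,v}:c_uc_v\Rightarrow c_wc_{w'}$ for each ordered pair $(u,v)$ of columns not forming a tableau, where $w,w'$ are the left and right columns of the Schensted tableau $P(uv)$ (with $c_{w'}$ empty if $P(uv)$ is a single column). -}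

module Defs where

open import Data.Nat using (ℕ; zero; suc; _+_; _∸_)
open import Data.Bool using (Bool; true; false; _∧_)
open import Data.Fin using (Fin) renaming (_>_ to _>ᶠ_; _≤?_ to _≤ᶠ?_)
open import Data.List using (List; []; _∷_; reverse; map; concatMap; applyUpTo; foldr)
open import Data.List.Relation.Unary.Linked using (Linked)
open import Data.Product using (Σ; _×_; _,_; proj₁)
open import Data.Integer using (+_)
open import Data.Rational using (ℚ; _/_; _*_; 1ℚ; 0ℚ)
open import Relation.Nullary.Decidable using (⌊_⌋)
open import Relation.Binary.PropositionalEquality using (_≡_)

-- The alphabet [n] = {1 < ... < n} is modelled by Fin n (0 < ... < n-1),
-- an order-isomorphic copy.

data NonEmpty {A : Set} : List A → Set where
  nonempty : ∀ {x xs} → NonEmpty (x ∷ xs)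

IsColumn : ∀ {n} → List (Fin n) → Set
IsColumn w = NonEmpty w × Linked _>ᶠ_ w

-- col(n): the set of nonempty columns; one generator c_u per u ∈ col(n).
Col : ℕ → Set
Col n = Σ (List (Fin n)) IsColumn

dominatedᵇ : ∀ {n} → List (Fin n) → List (Fin n) → Bool
dominatedᵇ xs       []       = true
dominatedᵇ []       (y ∷ ys) = false
dominatedᵇ (x ∷ xs) (y ∷ ys) = ⌊ x ≤ᶠ? y ⌋ ∧ dominatedᵇ xs ys

-- (u,v) forms a tableau, for u = x_p...x_1 and v = y_q...y_1 written as words
-- (leftmost letter first): p ≥ q and x_i ≤ y_i for i ≤ q.  The indices count
-- from the right end of the words, hence the reversals.
formsTableauᵇ : ∀ {n} → List (Fin n) → List (Fin n) → Bool
formsTableauᵇ u v = dominatedᵇ (reverse u) (reverse v)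

Cell2 : ℕ → Set
Cell2 n = Σ (Col n × Col n) (λ uv → formsTableauᵇ (proj₁ (proj₁ uv)) (proj₁ (Data.Product.proj₂ uv)) ≡ false)

-- Rational number a / b (used only with b > 0; value 0 if b = 0).
frac : ℕ → ℕ → ℚ
frac a zero    = 0ℚ
frac a (suc b) = (+ a) / suc b

prodℚ : List ℚ → ℚ
prodℚ = foldr _*_ 1ℚ

∏≤ : ℕ → (ℕ → ℕ → ℚ) → ℚ
∏≤ n f = prodℚ (concatMap (λ j → map (λ i → f i j) (applyUpTo suc j)) (applyUpTo suc n))

module Submission where

-- A column is determined by its set of letters, so columns are the nonempty
-- subsets of [n] and κ₁ = 2ⁿ - 1.  Two subsets u, v form a tableau exactly when
-- every initial segment of [n] contains at least as many letters of u as of v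
-- (a ballot condition).  Allowing a head start of d letters for u, the number
-- of such pairs satisfies the same recursion in n as the window sums
-- Σ_{k ≤ d} C(2n+1, n+1+k) (Pascal's rule twice, plus the symmetry
-- C(2n+1, n) = C(2n+1, n+1)), so there are C(2n+1, n+1) tableau pairs.  Pairs
-- with v empty always form a tableau and pairs with only u empty never do,
-- whence κ₂ + C(2n+1, n+1) = κ₁² + 2ⁿ.  Finally the two products telescope,
-- column by column, to C(2n+1, n+1) and to 2ⁿ.

open import Defs

module ColumnCounting where

  open import Data.Bool using (Bool; true; false; T; not; _∧_)
  open import Data.Bool.Properties using (T-irrelevant; T-∧)
  open import Data.Fin as Fin using (Fin; zero; suc) renaming (_<_ to _<ᶠ_; _≤?_ to _≤ᶠ?_)
  open import Data.Fin.Properties as Finₚ using (+↔⊎)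
  open import Data.Fin.Subset using (Subset; inside; outside)
  open import Data.List using (List; []; _∷_; _++_; map; null; reverse; _ʳ++_; applyUpTo; concatMap)
  open import Data.List.Properties using (reverse-involutive; map-injective; ∷-injectiveʳ; map-applyUpTo)
  open import Data.List.Relation.Unary.Linked.Properties using (map⁺; map⁻)
  open import Data.List.Relation.Unary.Linked as Linked using (Linked; []; [-]; _∷_)
  open import Data.Nat as ℕ using (ℕ; zero; suc; _+_; _*_; _^_; _∸_; _!; _≤_; _<_)
  open import Data.Nat.Combinatorics
    using (_C_; nCk≡nC[n∸k]; nCk+nC[k+1]≡[n+1]C[k+1]; k>n⇒nCk≡0; nCk≡n!/k![n-k]!; k![n∸k]!∣n!)
  open import Data.Nat.DivMod using (m/n*n≡m)
  import Data.Integer as ℤ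
  import Data.Integer.Properties as ℤₚ
  open import Data.Rational using (ℚ; 1ℚ; toℚᵘ) renaming (_*_ to _*ℚ_; _+_ to _+ℚ_; _-_ to _-ℚ_)
  open import Data.Rational.Properties as ℚₚ
    using (toℚᵘ-injective; toℚᵘ-fromℚᵘ; toℚᵘ-homo-*; toℚᵘ-homo-+; fromℚᵘ-cong)
  open import Data.Rational.Solver using (module +-*-Solver)
  open import Data.Rational.Unnormalised as ℚᵘ using (mkℚᵘ; *≡*)
  import Data.Rational.Unnormalised.Properties as ℚᵘₚ
  open import Data.Nat.Tactic.RingSolver using (solve-∀)
  open import Data.Nat.Properties
  open import Algebra.Properties.CommutativeSemigroup +-commutativeSemigroup using (interchange; xy∙z≈xz∙y)
  import Algebra.Properties.CommutativeSemigroup *-commutativeSemigroup as *-CS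
  open import Data.Product using (Σ; _×_; _,_; proj₁; proj₂)
  open import Data.Product.Properties using (Σ-≡,≡→≡)
  open import Data.Product.Function.Dependent.Propositional using (congˡ) renaming (cong to Σ-cong)
  open import Data.Product.Function.NonDependent.Propositional using (_×-↔_)
  open import Data.Sum using (_⊎_; inj₁; inj₂)
  open import Data.Sum.Function.Propositional using (_⊎-↔_)
  open import Data.Vec using ([]; _∷_)
  open import Function using (_∘_; flip; Equivalence)
  open import Function.Bundles using (_↔_; mk↔ₛ′; Inverse)
  open import Function.Properties.Inverse using (↔-trans; ↔-sym)
  open import Function.Related.TypeIsomorphisms using (Σ-assoc)
  open import Relation.Binary.PropositionalEquality
  open import Relation.Nullary using (yes; no; contradiction)
  open import Relation.Nullary.Decidable using (⌊_⌋)

  -- Sums over the subsets of [n]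

  𝟙 : Bool → ℕ
  𝟙 true  = 1
  𝟙 false = 0

  ∑ : ∀ {n} → (Subset n → ℕ) → ℕ
  ∑ {zero}  f = f []
  ∑ {suc n} f = ∑ (f ∘ (inside ∷_)) + ∑ (f ∘ (outside ∷_))

  ∑₂ : ∀ {n} → (Subset n → Subset n → ℕ) → ℕ
  ∑₂ f = ∑ λ a → ∑ λ b → f a b

  ∑-cong : ∀ {n} {f g : Subset n → ℕ} → (∀ w → f w ≡ g w) → ∑ f ≡ ∑ g
  ∑-cong {zero}  f≗g = f≗g []
  ∑-cong {suc n} f≗g = cong₂ _+_ (∑-cong (f≗g ∘ (inside ∷_))) (∑-cong (f≗g ∘ (outside ∷_)))

  ∑-distrib-+ : ∀ {n} (f g : Subset n → ℕ) → ∑ (λ w → f w + g w) ≡ ∑ f + ∑ g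
  ∑-distrib-+ {zero}  f g = refl
  ∑-distrib-+ {suc n} f g = begin
    ∑ (λ w → f (inside ∷ w) + g (inside ∷ w)) + ∑ (λ w → f (outside ∷ w) + g (outside ∷ w))
      ≡⟨ cong₂ _+_ (∑-distrib-+ (f ∘ (inside ∷_)) (g ∘ (inside ∷_)))
                   (∑-distrib-+ (f ∘ (outside ∷_)) (g ∘ (outside ∷_))) ⟩
    (∑ (f ∘ (inside ∷_)) + ∑ (g ∘ (inside ∷_))) + (∑ (f ∘ (outside ∷_)) + ∑ (g ∘ (outside ∷_)))
      ≡⟨ interchange
           (∑ (f ∘ (inside ∷_))) (∑ (g ∘ (inside ∷_))) (∑ (f ∘ (outside ∷_))) (∑ (g ∘ (outside ∷_))) ⟩
    ∑ f + ∑ g ∎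
    where open ≡-Reasoning

  ∑-*ˡ : ∀ {n} c (f : Subset n → ℕ) → ∑ (λ w → c * f w) ≡ c * ∑ f
  ∑-*ˡ {zero}  c f = refl
  ∑-*ˡ {suc n} c f =
    trans (cong₂ _+_ (∑-*ˡ c (f ∘ (inside ∷_))) (∑-*ˡ c (f ∘ (outside ∷_))))
          (sym (*-distribˡ-+ c _ _))

  ∑-*ʳ : ∀ {n} (f : Subset n → ℕ) c → ∑ (λ w → f w * c) ≡ ∑ f * c
  ∑-*ʳ f c = trans (∑-cong (λ w → *-comm (f w) c)) (trans (∑-*ˡ c f) (*-comm c (∑ f)))

  ∑-const : ∀ n c → ∑ {n} (λ _ → c) ≡ 2 ^ n * c
  ∑-const zero    c = sym (*-identityˡ c)
  ∑-const (suc n) c = begin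
    ∑ {n} (λ _ → c) + ∑ {n} (λ _ → c) ≡⟨ cong (λ s → s + s) (∑-const n c) ⟩
    2 ^ n * c + 2 ^ n * c             ≡⟨ *-distribʳ-+ c (2 ^ n) (2 ^ n) ⟨
    (2 ^ n + 2 ^ n) * c               ≡⟨ cong (λ m → (2 ^ n + m) * c) (+-identityʳ (2 ^ n)) ⟨
    2 ^ suc n * c                     ∎
    where open ≡-Reasoning

  ∑-zero : ∀ n → ∑ {n} (λ _ → 0) ≡ 0
  ∑-zero n = trans (∑-const n 0) (*-zeroʳ (2 ^ n))

  ∑-one : ∀ n → ∑ {n} (λ _ → 1) ≡ 2 ^ n
  ∑-one n = trans (∑-const n 1) (*-identityʳ (2 ^ n))

  ∑₂-distrib-+ : ∀ {n} (f g : Subset n → Subset n → ℕ) →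
    ∑₂ (λ a b → f a b + g a b) ≡ ∑₂ f + ∑₂ g
  ∑₂-distrib-+ f g =
    trans (∑-cong (λ a → ∑-distrib-+ (f a) (g a))) (∑-distrib-+ (λ a → ∑ (f a)) (λ a → ∑ (g a)))

  ∑₂-* : ∀ {n} (f g : Subset n → ℕ) → ∑₂ (λ a b → f a * g b) ≡ ∑ f * ∑ g
  ∑₂-* f g = trans (∑-cong (λ a → ∑-*ˡ (f a) g)) (∑-*ʳ f (∑ g))

  ∑₂-suc : ∀ {n} (f : Subset (suc n) → Subset (suc n) → ℕ) →
    ∑₂ f ≡ (∑₂ (λ a b → f (inside ∷ a) (inside ∷ b)) + ∑₂ (λ a b → f (inside ∷ a) (outside ∷ b)))
         + (∑₂ (λ a b → f (outside ∷ a) (inside ∷ b)) + ∑₂ (λ a b → f (outside ∷ a) (outside ∷ b)))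
  ∑₂-suc f = cong₂ _+_
    (∑-distrib-+ (λ a → ∑ (f (inside ∷ a) ∘ (inside ∷_))) (λ a → ∑ (f (inside ∷ a) ∘ (outside ∷_))))
    (∑-distrib-+ (λ a → ∑ (f (outside ∷ a) ∘ (inside ∷_))) (λ a → ∑ (f (outside ∷ a) ∘ (outside ∷_))))

  Σ-Subset-suc↔ : ∀ {n} (P : Subset (suc n) → Set) →
    Σ (Subset (suc n)) P ↔ (Σ (Subset n) (P ∘ (inside ∷_)) ⊎ Σ (Subset n) (P ∘ (outside ∷_)))
  Σ-Subset-suc↔ P = mk↔ₛ′
    (λ { (inside ∷ w , p) → inj₁ (w , p) ; (outside ∷ w , p) → inj₂ (w , p) })
    (λ { (inj₁ (w , p)) → inside ∷ w , p ; (inj₂ (w , p)) → outside ∷ w , p })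
    (λ { (inj₁ _) → refl ; (inj₂ _) → refl })
    (λ { (inside ∷ _ , _) → refl ; (outside ∷ _ , _) → refl })

  Σ-Fin↔Fin-∑ : ∀ {n} (f : Subset n → ℕ) → Σ (Subset n) (Fin ∘ f) ↔ Fin (∑ f)
  Σ-Fin↔Fin-∑ {zero}  f = mk↔ₛ′ (λ { ([] , i) → i }) ([] ,_) (λ _ → refl) (λ { ([] , _) → refl })
  Σ-Fin↔Fin-∑ {suc n} f = ↔-trans (Σ-Subset-suc↔ (Fin ∘ f))
    (↔-trans (Σ-Fin↔Fin-∑ _ ⊎-↔ Σ-Fin↔Fin-∑ _) (↔-sym +↔⊎))

  T↔Fin-𝟙 : ∀ b → T b ↔ Fin (𝟙 b)
  T↔Fin-𝟙 true  = mk↔ₛ′ (λ _ → zero) _ (λ { zero → refl }) (λ _ → refl)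
  T↔Fin-𝟙 false = mk↔ₛ′ (λ ()) (λ ()) (λ ()) (λ ())

  Σ-T↔Fin-∑ : ∀ {n} (p : Subset n → Bool) → Σ (Subset n) (T ∘ p) ↔ Fin (∑ (𝟙 ∘ p))
  Σ-T↔Fin-∑ p = ↔-trans (congˡ (T↔Fin-𝟙 _)) (Σ-Fin↔Fin-∑ (𝟙 ∘ p))

  Σ₂-T↔Fin-∑₂ : ∀ {n} (p : Subset n → Subset n → Bool) →
    Σ (Subset n × Subset n) (λ ab → T (p (proj₁ ab) (proj₂ ab))) ↔ Fin (∑₂ λ a b → 𝟙 (p a b))
  Σ₂-T↔Fin-∑₂ p = ↔-trans Σ-assoc
    (↔-trans (congˡ (Σ-T↔Fin-∑ (p _))) (Σ-Fin↔Fin-∑ _))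

  -- Subsets as increasing lists of letters

  elements : ∀ {n} → Subset n → List (Fin n)
  elements []            = []
  elements (inside  ∷ w) = zero ∷ map suc (elements w)
  elements (outside ∷ w) = map suc (elements w)

  Increasing : ∀ {n} → List (Fin n) → Set
  Increasing = Linked _<ᶠ_

  map-suc⁺ : ∀ {n} {xs : List (Fin n)} → Increasing xs → Increasing (map suc xs)
  map-suc⁺ = map⁺ ∘ Linked.map ℕ.s<s

  map-suc⁻ : ∀ {n} {xs : List (Fin n)} → Increasing (map suc xs) → Increasing xs
  map-suc⁻ = Linked.map ℕ.s<s⁻¹ ∘ map⁻

  zero∷map-suc⁺ : ∀ {n} {xs : List (Fin n)} → Increasing xs → Increasing (zero ∷ map suc xs)
  zero∷map-suc⁺ {xs = []}    _ = [-]
  zero∷map-suc⁺ {xs = _ ∷ _} l = ℕ.z<s ∷ map-suc⁺ l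

  elements-increasing : ∀ {n} (w : Subset n) → Increasing (elements w)
  elements-increasing []          = []
  elements-increasing (inside  ∷ w) = zero∷map-suc⁺ (elements-increasing w)
  elements-increasing (outside ∷ w) = map-suc⁺ (elements-increasing w)

  elements-injective : ∀ {n} {v w : Subset n} → elements v ≡ elements w → v ≡ w
  elements-injective {v = []}        {[]}        _ = refl
  elements-injective {v = inside ∷ v}  {inside ∷ w}  e =
    cong (inside ∷_) (elements-injective (map-injective Finₚ.suc-injective (∷-injectiveʳ e)))
  elements-injective {v = outside ∷ v} {outside ∷ w} e =
    cong (outside ∷_) (elements-injective (map-injective Finₚ.suc-injective e))
  elements-injective {v = inside ∷ v}  {outside ∷ w} e with elements w | e
  ... | _ ∷ _ | ()
  elements-injective {v = outside ∷ v} {inside ∷ w}  e with elements v | e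
  ... | _ ∷ _ | ()

  data ZeroView {n} : List (Fin (suc n)) → Set where
    without-zero : ∀ {zs} → Increasing zs → ZeroView (map suc zs)
    with-zero    : ∀ {zs} → Increasing zs → ZeroView (zero ∷ map suc zs)

  tail-shifted : ∀ {n} {x : Fin (suc n)} {ys} → Increasing (x ∷ ys) →
    Σ (List (Fin n)) λ zs → ys ≡ map suc zs × Increasing zs
  tail-shifted {ys = []}          _           = [] , refl , []
  tail-shifted {ys = zero ∷ _}    (() ∷ _)
  tail-shifted {ys = suc y ∷ ys}  (_ ∷ l) with tail-shifted l
  ... | zs , refl , _ = y ∷ zs , refl , map-suc⁻ l

  zeroView : ∀ {n} {xs : List (Fin (suc n))} → Increasing xs → ZeroView xs
  zeroView {xs = []}        _ = without-zero {zs = []} []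
  zeroView {xs = zero ∷ _}  l with tail-shifted l
  ... | _ , refl , l′ = with-zero l′
  zeroView {xs = suc _ ∷ _} l with tail-shifted l
  ... | _ , refl , _ = without-zero (map-suc⁻ l)

  indicator : ∀ {n} (xs : List (Fin n)) → Increasing xs → Subset n
  indicator {zero}  _  _ = []
  indicator {suc n} xs l with zeroView l
  ... | without-zero {zs} l′ = outside ∷ indicator zs l′
  ... | with-zero    {zs} l′ = inside  ∷ indicator zs l′

  elements-indicator : ∀ {n} (xs : List (Fin n)) (l : Increasing xs) → elements (indicator xs l) ≡ xs
  elements-indicator {zero}  []  _ = refl
  elements-indicator {suc n} xs  l with zeroView l
  ... | without-zero {zs} l′ = cong (map suc) (elements-indicator zs l′)
  ... | with-zero    {zs} l′ = cong (λ ys → zero ∷ map suc ys) (elements-indicator zs l′)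

  -- Columns as nonempty subsets

  reverseAcc-nonEmpty : ∀ {A : Set} (xs : List A) {ys} → NonEmpty ys → NonEmpty (xs ʳ++ ys)
  reverseAcc-nonEmpty []       ne = ne
  reverseAcc-nonEmpty (x ∷ xs) _  = reverseAcc-nonEmpty xs nonempty

  reverse-nonEmpty : ∀ {A : Set} {xs : List A} → NonEmpty xs → NonEmpty (reverse xs)
  reverse-nonEmpty {xs = x ∷ xs} _ = reverseAcc-nonEmpty xs nonempty

  reverseAcc⁺ : ∀ {A : Set} {R : A → A → Set} {x : A} xs {ys} →
    Linked R (x ∷ xs) → Linked (flip R) (x ∷ ys) → Linked (flip R) (xs ʳ++ x ∷ ys)
  reverseAcc⁺ []       _         l = l
  reverseAcc⁺ (y ∷ xs) (Rxy ∷ l) l′ = reverseAcc⁺ xs l (Rxy ∷ l′)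

  reverse⁺ : ∀ {A : Set} {R : A → A → Set} {xs : List A} → Linked R xs → Linked (flip R) (reverse xs)
  reverse⁺ {xs = []}     _ = []
  reverse⁺ {xs = x ∷ xs} l = reverseAcc⁺ xs l [-]

  nonEmpty-irrelevant : ∀ {A : Set} {xs : List A} (p q : NonEmpty xs) → p ≡ q
  nonEmpty-irrelevant nonempty nonempty = refl

  isColumn-irrelevant : ∀ {n} {u : List (Fin n)} (p q : IsColumn u) → p ≡ q
  isColumn-irrelevant (ne , l) (ne′ , l′) =
    cong₂ _,_ (nonEmpty-irrelevant ne ne′) (Linked.irrelevant Finₚ.<-irrelevant l l′)

  column : ∀ {n} → Subset n → List (Fin n)
  column w = reverse (elements w)

  nonemptyᵇ : ∀ {n} → Subset n → Bool
  nonemptyᵇ w = not (null (elements w))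

  nonEmpty⇒T-not-null : ∀ {n} {xs : List (Fin n)} → NonEmpty xs → T (not (null xs))
  nonEmpty⇒T-not-null nonempty = _

  column-isColumn : ∀ {n} (w : Subset n) → T (nonemptyᵇ w) → IsColumn (column w)
  column-isColumn w t with elements w | elements-increasing w
  ... | x ∷ xs | l = reverse-nonEmpty {xs = x ∷ xs} nonempty , reverse⁺ l

  reverse-column : ∀ {n} (w : Subset n) → reverse (column w) ≡ elements w
  reverse-column w = reverse-involutive (elements w)

  Col↔nonempty-Subset : ∀ {n} → Col n ↔ Σ (Subset n) (T ∘ nonemptyᵇ)
  Col↔nonempty-Subset = mk↔ₛ′ to from to∘from from∘to
    where
    to : Col _ → Σ (Subset _) (T ∘ nonemptyᵇ)
    to (u , ne , l) = indicator (reverse u) (reverse⁺ l) ,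
      subst (T ∘ not ∘ null) (sym (elements-indicator (reverse u) (reverse⁺ l)))
            (nonEmpty⇒T-not-null (reverse-nonEmpty ne))
    from : Σ (Subset _) (T ∘ nonemptyᵇ) → Col _
    from (w , t) = column w , column-isColumn w t
    to∘from : ∀ wt → to (from wt) ≡ wt
    to∘from (w , t) = Σ-≡,≡→≡
      (elements-injective (trans (elements-indicator _ _) (reverse-column w)) , T-irrelevant _ _)
    from∘to : ∀ c → from (to c) ≡ c
    from∘to (u , c) = Σ-≡,≡→≡
      (trans (cong reverse (elements-indicator _ _)) (reverse-involutive u) , isColumn-irrelevant _ _)

  tableauᵇ : ∀ {n} → Subset n → Subset n → Bool
  tableauᵇ a b = formsTableauᵇ (column a) (column b)

  cellᵇ : ∀ {n} → Subset n → Subset n → Bool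
  cellᵇ a b = nonemptyᵇ a ∧ nonemptyᵇ b ∧ not (tableauᵇ a b)

  ≡false↔T-not : ∀ {x y} → x ≡ y → (x ≡ false) ↔ T (not y)
  ≡false↔T-not {true}  refl = mk↔ₛ′ (λ ()) (λ ()) (λ ()) (λ ())
  ≡false↔T-not {false} refl = mk↔ₛ′ _ (λ _ → refl) (λ _ → refl) (λ { refl → refl })

  Σ²-T↔Σ-T-∧ : ∀ {A : Set} (p : A → Bool) (q : A → A → Bool) →
    Σ (Σ A (T ∘ p) × Σ A (T ∘ p)) (λ xy → T (q (proj₁ (proj₁ xy)) (proj₁ (proj₂ xy))))
      ↔ Σ (A × A) (λ ab → T (p (proj₁ ab) ∧ p (proj₂ ab) ∧ q (proj₁ ab) (proj₂ ab)))
  Σ²-T↔Σ-T-∧ p q = mk↔ₛ′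
    (λ { (((a , pa) , (b , pb)) , qab) →
           (a , b) , Equivalence.from T-∧ (pa , Equivalence.from T-∧ (pb , qab)) })
    (λ { ((a , b) , t) → let (pa , t′) = Equivalence.to T-∧ t; (pb , qab) = Equivalence.to T-∧ t′
                          in ((a , pa) , (b , pb)) , qab })
    (λ _ → Σ-≡,≡→≡ (refl , T-irrelevant _ _))
    (λ _ → Σ-≡,≡→≡ (cong₂ _,_ (Σ-≡,≡→≡ (refl , T-irrelevant _ _)) (Σ-≡,≡→≡ (refl , T-irrelevant _ _)) ,
                    T-irrelevant _ _))

  Cell2↔cell-Subset² : ∀ {n} → Cell2 n ↔ Σ (Subset n × Subset n) (λ ab → T (cellᵇ (proj₁ ab) (proj₂ ab)))
  Cell2↔cell-Subset² = ↔-trans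
    (Σ-cong (Col↔nonempty-Subset ×-↔ Col↔nonempty-Subset)
      λ { {u , v} → ≡false↔T-not (cong₂ formsTableauᵇ (sym (column-toSubset u)) (sym (column-toSubset v))) })
    (Σ²-T↔Σ-T-∧ nonemptyᵇ (λ a b → not (tableauᵇ a b)))
    where
    column-toSubset : ∀ {n} (u : Col n) → column (proj₁ (Inverse.to Col↔nonempty-Subset u)) ≡ proj₁ u
    column-toSubset u = cong proj₁ (Inverse.strictlyInverseʳ Col↔nonempty-Subset u)

  -- Cells versus tableau pairs

  𝟙-not+𝟙 : ∀ b → 𝟙 (not b) + 𝟙 b ≡ 1
  𝟙-not+𝟙 true  = refl
  𝟙-not+𝟙 false = refl

  -- A pair with empty right part always forms a tableau, one with only the left part empty never does.
  𝟙-cell+𝟙-dominated : ∀ {n} (xs ys : List (Fin n)) →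
    𝟙 (not (null xs) ∧ not (null ys) ∧ not (dominatedᵇ xs ys)) + 𝟙 (dominatedᵇ xs ys)
      ≡ 𝟙 (not (null xs)) * 𝟙 (not (null ys)) + 𝟙 (null ys)
  𝟙-cell+𝟙-dominated []      []      = refl
  𝟙-cell+𝟙-dominated (_ ∷ _) []      = refl
  𝟙-cell+𝟙-dominated []      (_ ∷ _) = refl
  𝟙-cell+𝟙-dominated (x ∷ xs) (y ∷ ys) = 𝟙-not+𝟙 (dominatedᵇ (x ∷ xs) (y ∷ ys))

  tableauᵇ≡dominatedᵇ : ∀ {n} (a b : Subset n) → tableauᵇ a b ≡ dominatedᵇ (elements a) (elements b)
  tableauᵇ≡dominatedᵇ a b = cong₂ dominatedᵇ (reverse-column a) (reverse-column b)

  null-map : ∀ {A B : Set} (f : A → B) (xs : List A) → null (map f xs) ≡ null xs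
  null-map f []      = refl
  null-map f (_ ∷ _) = refl

  ∑-𝟙-empty : ∀ n → ∑ {n} (λ w → 𝟙 (null (elements w))) ≡ 1
  ∑-𝟙-empty zero    = refl
  ∑-𝟙-empty (suc n) = cong₂ _+_
    (∑-zero n)
    (trans (∑-cong {n} (λ w → cong 𝟙 (null-map Fin.suc (elements w)))) (∑-𝟙-empty n))

  nonemptyCount : ℕ → ℕ
  nonemptyCount n = ∑ {n} (𝟙 ∘ nonemptyᵇ)

  cellCount : ℕ → ℕ
  cellCount n = ∑₂ {n} λ a b → 𝟙 (cellᵇ a b)

  tableauCount : ℕ → ℕ
  tableauCount n = ∑₂ {n} λ a b → 𝟙 (tableauᵇ a b)

  nonemptyCount+1 : ∀ n → nonemptyCount n + 1 ≡ 2 ^ n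
  nonemptyCount+1 n = begin
    nonemptyCount n + 1
      ≡⟨ cong (nonemptyCount n +_) (∑-𝟙-empty n) ⟨
    nonemptyCount n + ∑ {n} (λ w → 𝟙 (null (elements w)))
      ≡⟨ ∑-distrib-+ {n} (𝟙 ∘ nonemptyᵇ) (λ w → 𝟙 (null (elements w))) ⟨
    ∑ {n} (λ w → 𝟙 (nonemptyᵇ w) + 𝟙 (null (elements w)))
      ≡⟨ ∑-cong {n} (λ w → 𝟙-not+𝟙 (null (elements w))) ⟩
    ∑ {n} (λ _ → 1)
      ≡⟨ ∑-one n ⟩
    2 ^ n ∎
    where open ≡-Reasoning

  cellCount+tableauCount : ∀ n → cellCount n + tableauCount n ≡ nonemptyCount n * nonemptyCount n + 2 ^ n
  cellCount+tableauCount n = begin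
    cellCount n + tableauCount n
      ≡⟨ ∑₂-distrib-+ {n} (λ a b → 𝟙 (cellᵇ a b)) (λ a b → 𝟙 (tableauᵇ a b)) ⟨
    ∑₂ {n} (λ a b → 𝟙 (cellᵇ a b) + 𝟙 (tableauᵇ a b))
      ≡⟨ ∑-cong {n} (λ a → ∑-cong {n} (λ b → pointwise a b)) ⟩
    ∑₂ {n} (λ a b → 𝟙 (nonemptyᵇ a) * 𝟙 (nonemptyᵇ b) + 𝟙 (null (elements b)))
      ≡⟨ ∑₂-distrib-+ {n} (λ a b → 𝟙 (nonemptyᵇ a) * 𝟙 (nonemptyᵇ b)) (λ _ b → 𝟙 (null (elements b))) ⟩
    ∑₂ {n} (λ a b → 𝟙 (nonemptyᵇ a) * 𝟙 (nonemptyᵇ b)) + ∑₂ {n} (λ _ b → 𝟙 (null (elements b)))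
      ≡⟨ cong₂ _+_ (∑₂-* {n} (𝟙 ∘ nonemptyᵇ) (𝟙 ∘ nonemptyᵇ))
                   (trans (∑-cong {n} (λ _ → ∑-𝟙-empty n)) (∑-one n)) ⟩
    nonemptyCount n * nonemptyCount n + 2 ^ n ∎
    where
    open ≡-Reasoning
    pointwise : ∀ a b → 𝟙 (cellᵇ a b) + 𝟙 (tableauᵇ a b)
                      ≡ 𝟙 (nonemptyᵇ a) * 𝟙 (nonemptyᵇ b) + 𝟙 (null (elements b))
    pointwise a b rewrite tableauᵇ≡dominatedᵇ a b = 𝟙-cell+𝟙-dominated (elements a) (elements b)

  -- The tableau condition as a ballot condition

  -- ballotᵇ d a b: reading the letters upwards, every letter of b outside a
  -- finds an unmatched earlier letter of a or one of d extra tokens.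
  ballotᵇ : ∀ {n} → ℕ → Subset n → Subset n → Bool
  ballotᵇ d       []            []            = true
  ballotᵇ d       (inside ∷ a)  (inside ∷ b)  = ballotᵇ d a b
  ballotᵇ d       (inside ∷ a)  (outside ∷ b) = ballotᵇ (suc d) a b
  ballotᵇ d       (outside ∷ a) (outside ∷ b) = ballotᵇ d a b
  ballotᵇ zero    (outside ∷ a) (inside ∷ b)  = false
  ballotᵇ (suc d) (outside ∷ a) (inside ∷ b)  = ballotᵇ d a b

  -- xs, preceded by d letters smaller than every letter of ys, is dominated by ys.
  dominatedAfterᵇ : ∀ {n} → ℕ → List (Fin n) → List (Fin n) → Bool
  dominatedAfterᵇ zero    xs ys       = dominatedᵇ xs ys
  dominatedAfterᵇ (suc d) xs []       = true
  dominatedAfterᵇ (suc d) xs (_ ∷ ys) = dominatedAfterᵇ d xs ys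

  ⌊suc≤?suc⌋ : ∀ {n} (x y : Fin n) → ⌊ suc x ≤ᶠ? suc y ⌋ ≡ ⌊ x ≤ᶠ? y ⌋
  ⌊suc≤?suc⌋ x y with x ≤ᶠ? y | suc x ≤ᶠ? suc y
  ... | yes _   | yes _   = refl
  ... | no  _   | no  _   = refl
  ... | yes x≤y | no  x≰y = contradiction (ℕ.s≤s x≤y) x≰y
  ... | no  x≰y | yes x≤y = contradiction (ℕ.s≤s⁻¹ x≤y) x≰y

  dominatedᵇ-map-suc : ∀ {n} (xs ys : List (Fin n)) → dominatedᵇ (map suc xs) (map suc ys) ≡ dominatedᵇ xs ys
  dominatedᵇ-map-suc []       []       = refl
  dominatedᵇ-map-suc (_ ∷ _)  []       = refl
  dominatedᵇ-map-suc []       (_ ∷ _)  = refl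
  dominatedᵇ-map-suc (x ∷ xs) (y ∷ ys) = cong₂ _∧_ (⌊suc≤?suc⌋ x y) (dominatedᵇ-map-suc xs ys)

  dominatedAfterᵇ-map-suc : ∀ {n} d (xs ys : List (Fin n)) →
    dominatedAfterᵇ d (map suc xs) (map suc ys) ≡ dominatedAfterᵇ d xs ys
  dominatedAfterᵇ-map-suc zero    xs ys       = dominatedᵇ-map-suc xs ys
  dominatedAfterᵇ-map-suc (suc d) xs []       = refl
  dominatedAfterᵇ-map-suc (suc d) xs (_ ∷ ys) = dominatedAfterᵇ-map-suc d xs ys

  dominatedAfterᵇ-zero∷ : ∀ {n} d (xs ys : List (Fin n)) →
    dominatedAfterᵇ d (zero ∷ map suc xs) (map suc ys) ≡ dominatedAfterᵇ (suc d) xs ys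
  dominatedAfterᵇ-zero∷ zero    xs []       = refl
  dominatedAfterᵇ-zero∷ zero    xs (_ ∷ ys) = dominatedᵇ-map-suc xs ys
  dominatedAfterᵇ-zero∷ (suc d) xs []       = refl
  dominatedAfterᵇ-zero∷ (suc d) xs (_ ∷ ys) = dominatedAfterᵇ-zero∷ d xs ys

  dominatedAfterᵇ≡ballotᵇ : ∀ {n} d (a b : Subset n) →
    dominatedAfterᵇ d (elements a) (elements b) ≡ ballotᵇ d a b
  dominatedAfterᵇ≡ballotᵇ zero    []            []            = refl
  dominatedAfterᵇ≡ballotᵇ (suc d) []            []            = refl
  dominatedAfterᵇ≡ballotᵇ zero    (inside ∷ a)  (inside ∷ b)  =
    trans (dominatedᵇ-map-suc (elements a) (elements b)) (dominatedAfterᵇ≡ballotᵇ zero a b)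
  dominatedAfterᵇ≡ballotᵇ (suc d) (inside ∷ a)  (inside ∷ b)  =
    trans (dominatedAfterᵇ-zero∷ d (elements a) (elements b)) (dominatedAfterᵇ≡ballotᵇ (suc d) a b)
  dominatedAfterᵇ≡ballotᵇ d       (inside ∷ a)  (outside ∷ b) =
    trans (dominatedAfterᵇ-zero∷ d (elements a) (elements b)) (dominatedAfterᵇ≡ballotᵇ (suc d) a b)
  dominatedAfterᵇ≡ballotᵇ zero    (outside ∷ a) (inside ∷ b)  with elements a
  ... | []    = refl
  ... | _ ∷ _ = refl
  dominatedAfterᵇ≡ballotᵇ (suc d) (outside ∷ a) (inside ∷ b)  =
    trans (dominatedAfterᵇ-map-suc d (elements a) (elements b)) (dominatedAfterᵇ≡ballotᵇ d a b)
  dominatedAfterᵇ≡ballotᵇ d       (outside ∷ a) (outside ∷ b) =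
    trans (dominatedAfterᵇ-map-suc d (elements a) (elements b)) (dominatedAfterᵇ≡ballotᵇ d a b)

  tableauᵇ≡ballotᵇ : ∀ {n} (a b : Subset n) → tableauᵇ a b ≡ ballotᵇ 0 a b
  tableauᵇ≡ballotᵇ a b = trans (tableauᵇ≡dominatedᵇ a b) (dominatedAfterᵇ≡ballotᵇ 0 a b)

  -- Counting tableau pairs with binomial coefficients

  nCk*k![n∸k]!≡n! : ∀ {n k} → k ≤ n → (n C k) * (k ! * (n ∸ k) !) ≡ n !
  nCk*k![n∸k]!≡n! {n} {k} k≤n =
    trans (cong (_* (k ! * (n ∸ k) !)) (nCk≡n!/k![n-k]! k≤n)) (m/n*n≡m (k![n∸k]!∣n! k≤n))
    where instance _ = k !* (n ∸ k) !≢0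

  [k+1]*[n+1]C[k+1]≡[n+1]*nCk : ∀ n k → suc k * (suc n C suc k) ≡ suc n * (n C k)
  [k+1]*[n+1]C[k+1]≡[n+1]*nCk n k with ≤-<-connex k n
  ... | inj₂ n<k = begin
    suc k * (suc n C suc k) ≡⟨ cong (suc k *_) (k>n⇒nCk≡0 (ℕ.s<s n<k)) ⟩
    suc k * 0               ≡⟨ *-zeroʳ (suc k) ⟩
    0                       ≡⟨ *-zeroʳ (suc n) ⟨
    suc n * 0               ≡⟨ cong (suc n *_) (k>n⇒nCk≡0 n<k) ⟨
    suc n * (n C k)         ∎
    where open ≡-Reasoning
  ... | inj₁ k≤n = *-cancelʳ-≡ _ _ (k ! * (n ∸ k) !) (begin
    suc k * (suc n C suc k) * (k ! * (n ∸ k) !)   ≡⟨ rearrange (suc k) (suc n C suc k) (k !) ((n ∸ k) !) ⟩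
    (suc n C suc k) * (suc k ! * (suc n ∸ suc k) !) ≡⟨ nCk*k![n∸k]!≡n! (ℕ.s≤s k≤n) ⟩
    suc n * n !                                   ≡⟨ cong (suc n *_) (nCk*k![n∸k]!≡n! k≤n) ⟨
    suc n * ((n C k) * (k ! * (n ∸ k) !))         ≡⟨ *-assoc (suc n) (n C k) _ ⟨
    suc n * (n C k) * (k ! * (n ∸ k) !)           ∎)
    where
    open ≡-Reasoning
    instance _ = k !* (n ∸ k) !≢0
    rearrange : ∀ a c f r → a * c * (f * r) ≡ c * (a * f * r)
    rearrange = solve-∀

  window : ℕ → ℕ → ℕ → ℕ
  window m a zero    = 0
  window m a (suc d) = m C a + window m (suc a) d

  window-pascal : ∀ m a d → window (suc m) (suc a) d ≡ window m a d + window m (suc a) d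
  window-pascal m a zero    = refl
  window-pascal m a (suc d) = begin
    (suc m C suc a) + window (suc m) (suc (suc a)) d
      ≡⟨ cong₂ _+_ (sym (nCk+nC[k+1]≡[n+1]C[k+1] m a)) (window-pascal m (suc a) d) ⟩
    ((m C a) + (m C suc a)) + (window m (suc a) d + window m (suc (suc a)) d)
      ≡⟨ interchange (m C a) (m C suc a) (window m (suc a) d) (window m (suc (suc a)) d) ⟩
    window m a (suc d) + window m (suc a) (suc d) ∎
    where open ≡-Reasoning

  window-beyond : ∀ m a d → m < a → window m a d ≡ 0
  window-beyond m a zero    m<a = refl
  window-beyond m a (suc d) m<a = cong₂ _+_ (k>n⇒nCk≡0 m<a) (window-beyond m (suc a) d (m<n⇒m<1+n m<a))

  -- The two sides have the same terms, except m C a on the left for m C (a + 1) on the right.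
  window-shift : ∀ m a d → (m C a) ≡ (m C suc a) →
    window m a (suc d) + window m (suc (suc a)) (suc d) ≡ window m (suc a) (suc (suc d)) + window m (suc a) d
  window-shift m a d C-sym = begin
    ((m C a) + window m (suc a) d) + window m (suc (suc a)) (suc d)
      ≡⟨ xy∙z≈xz∙y (m C a) (window m (suc a) d) _ ⟩
    ((m C a) + window m (suc (suc a)) (suc d)) + window m (suc a) d
      ≡⟨ cong (λ c → (c + window m (suc (suc a)) (suc d)) + window m (suc a) d) C-sym ⟩
    window m (suc a) (suc (suc d)) + window m (suc a) d ∎
    where open ≡-Reasoning

  [2n+1]Cn≡[2n+1]C[n+1] : ∀ n → (suc (n + n) C n) ≡ (suc (n + n) C suc n)
  [2n+1]Cn≡[2n+1]C[n+1] n = trans (nCk≡nC[n∸k] n≤2n+1) (cong (suc (n + n) C_) (m+n∸n≡m (suc n) n))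
    where
    n≤2n+1 : n ≤ suc (n + n)
    n≤2n+1 = m≤n⇒m≤1+n (m≤m+n n n)

  ballotCount : ℕ → ℕ → ℕ
  ballotCount n d = ∑₂ {n} λ a b → 𝟙 (ballotᵇ d a b)

  ballotCount≡window : ∀ n d → ballotCount n d ≡ window (suc (n + n)) (suc n) (suc d)
  ballotCount≡window zero    d = sym (cong (1 +_) (window-beyond 1 2 d ≤-refl))
  ballotCount≡window (suc n) d = begin
    ballotCount (suc n) d
      ≡⟨ ∑₂-suc {n} (λ a b → 𝟙 (ballotᵇ d a b)) ⟩
    (ballotCount n d + ballotCount n (suc d)) + (blocked d + ballotCount n d)
      ≡⟨ cong₂ (λ x y → (x + y) + (blocked d + x)) (ballotCount≡window n d) (ballotCount≡window n (suc d)) ⟩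
    (W (suc d) + W (suc (suc d))) + (blocked d + W (suc d))
      ≡⟨ cong (λ z → (W (suc d) + W (suc (suc d))) + (z + W (suc d))) (blocked≡window d) ⟩
    (W (suc d) + W (suc (suc d))) + (W d + W (suc d))
      ≡⟨ regroup (W (suc d)) (W (suc (suc d))) (W d) (window m n (suc d)) (window m (suc (suc n)) (suc d))
                 (window-shift m n d ([2n+1]Cn≡[2n+1]C[n+1] n)) ⟩
    (window m n (suc d) + W (suc d)) + (W (suc d) + window m (suc (suc n)) (suc d))
      ≡⟨ cong₂ _+_ (window-pascal m n (suc d)) (window-pascal m (suc n) (suc d)) ⟨
    window (suc m) (suc n) (suc d) + window (suc m) (suc (suc n)) (suc d)
      ≡⟨ window-pascal (suc m) (suc n) (suc d) ⟨
    window (suc (suc m)) (suc (suc n)) (suc d)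
      ≡⟨ cong (λ k → window (suc (suc k)) (suc (suc n)) (suc d)) (+-suc n n) ⟨
    window (suc (suc n + suc n)) (suc (suc n)) (suc d) ∎
    where
    open ≡-Reasoning
    m : ℕ
    m = suc (n + n)
    W : ℕ → ℕ
    W = window m (suc n)
    blocked : ℕ → ℕ
    blocked d = ∑₂ {n} λ a b → 𝟙 (ballotᵇ d (outside ∷ a) (inside ∷ b))
    blocked≡window : ∀ d → blocked d ≡ W d
    blocked≡window zero    = trans (∑-cong {n} (λ _ → ∑-zero n)) (∑-zero n)
    blocked≡window (suc d) = ballotCount≡window n d
    regroup : ∀ a b c p q → p + q ≡ b + c → (a + b) + (c + a) ≡ (p + a) + (a + q)
    regroup a b c p q p+q≡b+c = begin
      (a + b) + (c + a) ≡⟨ split a b c ⟩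
      (b + c) + (a + a) ≡⟨ cong (_+ (a + a)) p+q≡b+c ⟨
      (p + q) + (a + a) ≡⟨ split a p q ⟨
      (a + p) + (q + a) ≡⟨ cong₂ _+_ (+-comm a p) (+-comm q a) ⟩
      (p + a) + (a + q) ∎
      where
      split : ∀ a b c → (a + b) + (c + a) ≡ (b + c) + (a + a)
      split = solve-∀

  tableauCount≡[2n+1]C[n+1] : ∀ n → tableauCount n ≡ suc (n + n) C suc n
  tableauCount≡[2n+1]C[n+1] n = begin
    tableauCount n            ≡⟨ ∑-cong {n} (λ a → ∑-cong (λ b → cong 𝟙 (tableauᵇ≡ballotᵇ a b))) ⟩
    ballotCount n 0           ≡⟨ ballotCount≡window n 0 ⟩
    (suc (n + n) C suc n) + 0 ≡⟨ +-identityʳ _ ⟩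
    suc (n + n) C suc n       ∎
    where open ≡-Reasoning

  [2n+3]C[n+2]-step : ∀ k → (suc (suc k + suc k) C suc (suc k)) * ((2 + k) * (1 + k))
                          ≡ (suc (k + k) C suc k) * (suc (suc k + suc k) * (suc k + suc k))
  [2n+3]C[n+2]-step k = begin
    C₃ * ((2 + k) * (1 + k))     ≡⟨ *-CS.x∙yz≈z∙yx C₃ (2 + k) (1 + k) ⟩
    (1 + k) * ((2 + k) * C₃)     ≡⟨ cong ((1 + k) *_) ([k+1]*[n+1]C[k+1]≡[n+1]*nCk (suc k + suc k) (suc k)) ⟩
    (1 + k) * (3+2k * C₂)        ≡⟨ *-CS.x∙yz≈y∙xz (1 + k) 3+2k C₂ ⟩
    3+2k * ((1 + k) * C₂)        ≡⟨ cong (3+2k *_) ([k+1]*[n+1]C[k+1]≡[n+1]*nCk (k + suc k) k) ⟩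
    3+2k * (2+2k * ((k + suc k) C k)) ≡⟨ cong (λ c → 3+2k * (2+2k * c)) C≡C₁ ⟩
    3+2k * (2+2k * C₁)           ≡⟨ *-CS.x∙yz≈z∙xy 3+2k 2+2k C₁ ⟩
    C₁ * (3+2k * 2+2k)           ∎
    where
    open ≡-Reasoning
    C₁ C₂ C₃ 2+2k 3+2k : ℕ
    C₁ = suc (k + k) C suc k
    C₂ = (suc k + suc k) C suc k
    C₃ = suc (suc k + suc k) C suc (suc k)
    2+2k = suc k + suc k
    3+2k = suc 2+2k
    C≡C₁ : (k + suc k) C k ≡ C₁
    C≡C₁ = trans (cong (_C k) (+-suc k k)) ([2n+1]Cn≡[2n+1]C[n+1] k)

  -- The two products

  frac-cross : ∀ a b c d .{{_ : ℕ.NonZero b}} .{{_ : ℕ.NonZero d}} → a * d ≡ c * b → frac a b ≡ frac c d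
  frac-cross a (suc b) c (suc d) eq = fromℚᵘ-cong {mkℚᵘ (ℤ.+ a) b} {mkℚᵘ (ℤ.+ c) d} (*≡* (begin
    ℤ.+ a ℤ.* ℤ.+ suc d ≡⟨ ℤₚ.pos-* a (suc d) ⟨
    ℤ.+ (a * suc d)   ≡⟨ cong ℤ.+_ eq ⟩
    ℤ.+ (c * suc b)   ≡⟨ ℤₚ.pos-* c (suc b) ⟩
    ℤ.+ c ℤ.* ℤ.+ suc b ∎))
    where open ≡-Reasoning

  frac-* : ∀ a b c d .{{_ : ℕ.NonZero b}} .{{_ : ℕ.NonZero d}} → frac a b *ℚ frac c d ≡ frac (a * c) (b * d)
  frac-* a (suc b) c (suc d) = toℚᵘ-injective (begin
    toℚᵘ (frac a (suc b) *ℚ frac c (suc d))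
      ≈⟨ toℚᵘ-homo-* (frac a (suc b)) (frac c (suc d)) ⟩
    toℚᵘ (frac a (suc b)) ℚᵘ.* toℚᵘ (frac c (suc d))
      ≈⟨ ℚᵘₚ.*-cong (toℚᵘ-fromℚᵘ (mkℚᵘ (ℤ.+ a) b)) (toℚᵘ-fromℚᵘ (mkℚᵘ (ℤ.+ c) d)) ⟩
    mkℚᵘ (ℤ.+ a ℤ.* ℤ.+ c) (d + b * suc d)
      ≡⟨ cong (λ i → mkℚᵘ i (d + b * suc d)) (ℤₚ.pos-* a c) ⟨
    mkℚᵘ (ℤ.+ (a * c)) (d + b * suc d)
      ≈⟨ toℚᵘ-fromℚᵘ (mkℚᵘ (ℤ.+ (a * c)) (d + b * suc d)) ⟨
    toℚᵘ (frac (a * c) (suc b * suc d)) ∎)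
    where open ℚᵘₚ.≃-Reasoning

  frac-+ : ∀ a c → frac a 1 +ℚ frac c 1 ≡ frac (a + c) 1
  frac-+ a c = toℚᵘ-injective (begin
    toℚᵘ (frac a 1 +ℚ frac c 1)
      ≈⟨ toℚᵘ-homo-+ (frac a 1) (frac c 1) ⟩
    toℚᵘ (frac a 1) ℚᵘ.+ toℚᵘ (frac c 1)
      ≈⟨ ℚᵘₚ.+-cong (toℚᵘ-fromℚᵘ (mkℚᵘ (ℤ.+ a) 0)) (toℚᵘ-fromℚᵘ (mkℚᵘ (ℤ.+ c) 0)) ⟩
    mkℚᵘ (ℤ.+ a ℤ.* ℤ.+ 1 ℤ.+ ℤ.+ c ℤ.* ℤ.+ 1) 0
      ≡⟨ cong (λ i → mkℚᵘ i 0) (cong₂ ℤ._+_ (ℤₚ.*-identityʳ (ℤ.+ a)) (ℤₚ.*-identityʳ (ℤ.+ c))) ⟩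
    mkℚᵘ (ℤ.+ a ℤ.+ ℤ.+ c) 0
      ≡⟨ cong (λ i → mkℚᵘ i 0) (ℤₚ.pos-+ a c) ⟨
    mkℚᵘ (ℤ.+ (a + c)) 0
      ≈⟨ toℚᵘ-fromℚᵘ (mkℚᵘ (ℤ.+ (a + c)) 0) ⟨
    toℚᵘ (frac (a + c) 1) ∎)
    where open ℚᵘₚ.≃-Reasoning

  prodℚ-++ : ∀ xs ys → prodℚ (xs ++ ys) ≡ prodℚ xs *ℚ prodℚ ys
  prodℚ-++ []       ys = sym (ℚₚ.*-identityˡ (prodℚ ys))
  prodℚ-++ (x ∷ xs) ys = trans (cong (x *ℚ_) (prodℚ-++ xs ys)) (sym (ℚₚ.*-assoc x (prodℚ xs) (prodℚ ys)))

  prodℚ-concatMap : ∀ {A : Set} (g : A → List ℚ) xs → prodℚ (concatMap g xs) ≡ prodℚ (map (prodℚ ∘ g) xs)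
  prodℚ-concatMap g []       = refl
  prodℚ-concatMap g (x ∷ xs) =
    trans (prodℚ-++ (g x) (concatMap g xs)) (cong (prodℚ (g x) *ℚ_) (prodℚ-concatMap g xs))

  telescope-applyUpTo : ∀ (h F : ℕ → ℚ) → (∀ i → F i *ℚ h i ≡ F (suc i)) →
    ∀ m → F 0 *ℚ prodℚ (applyUpTo h m) ≡ F m
  telescope-applyUpTo h F step zero    = ℚₚ.*-identityʳ (F 0)
  telescope-applyUpTo h F step (suc m) = begin
    F 0 *ℚ (h 0 *ℚ prodℚ (applyUpTo (h ∘ suc) m)) ≡⟨ ℚₚ.*-assoc (F 0) (h 0) _ ⟨
    (F 0 *ℚ h 0) *ℚ prodℚ (applyUpTo (h ∘ suc) m) ≡⟨ cong (_*ℚ _) (step 0) ⟩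
    F 1 *ℚ prodℚ (applyUpTo (h ∘ suc) m)          ≡⟨ telescope-applyUpTo (h ∘ suc) (F ∘ suc) (step ∘ suc) m ⟩
    F (suc m)                                     ∎
    where open ≡-Reasoning

  telescope : ∀ (g F : ℕ → ℚ) → F 0 ≡ 1ℚ → (∀ i → F i *ℚ g (suc i) ≡ F (suc i)) →
    ∀ m → prodℚ (map g (applyUpTo suc m)) ≡ F m
  telescope g F F0≡1 step m = begin
    prodℚ (map g (applyUpTo suc m))      ≡⟨ cong prodℚ (map-applyUpTo suc g m) ⟩
    prodℚ (applyUpTo (g ∘ suc) m)        ≡⟨ ℚₚ.*-identityˡ _ ⟨
    1ℚ *ℚ prodℚ (applyUpTo (g ∘ suc) m)  ≡⟨ cong (_*ℚ _) F0≡1 ⟨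
    F 0 *ℚ prodℚ (applyUpTo (g ∘ suc) m) ≡⟨ telescope-applyUpTo (g ∘ suc) F step m ⟩
    F m                                  ∎
    where open ≡-Reasoning

  ∏column : (ℕ → ℕ → ℚ) → ℕ → ℚ
  ∏column f j = prodℚ (map (λ i → f i j) (applyUpTo suc j))

  ∏≤-columns : ∀ n f → ∏≤ n f ≡ prodℚ (map (∏column f) (applyUpTo suc n))
  ∏≤-columns n f = prodℚ-concatMap (λ j → map (λ i → f i j) (applyUpTo suc j)) (applyUpTo suc n)

  ∏column-[i+j+1]/[i+j-1] : ∀ k → ∏column (λ i j → frac (i + j + 1) (i + j ∸ 1)) (suc k)
    ≡ frac ((2 + suc k + k) * (1 + suc k + k)) ((2 + k) * (1 + k))
  ∏column-[i+j+1]/[i+j-1] k =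
    telescope (λ i → frac (i + suc k + 1) (i + suc k ∸ 1)) F
              (frac-cross (N 0) D 1 1 (*-comm D 1)) step (suc k)
    where
    N : ℕ → ℕ
    N m = (2 + m + k) * (1 + m + k)
    D : ℕ
    D = (2 + k) * (1 + k)
    F : ℕ → ℚ
    F m = frac (N m) D
    cross : ∀ i k → ((2 + i + k) * (1 + i + k)) * (suc i + suc k + 1) * ((2 + k) * (1 + k))
                  ≡ ((2 + suc i + k) * (1 + suc i + k)) * (((2 + k) * (1 + k)) * suc (i + k))
    cross = solve-∀
    step : ∀ i → F i *ℚ frac (suc i + suc k + 1) (suc i + suc k ∸ 1) ≡ F (suc i)
    step i = begin
      F i *ℚ frac (suc i + suc k + 1) (i + suc k)
        ≡⟨ cong (λ d → F i *ℚ frac (suc i + suc k + 1) d) (+-suc i k) ⟩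
      F i *ℚ frac (suc i + suc k + 1) (suc (i + k)) ≡⟨ frac-* (N i) D (suc i + suc k + 1) (suc (i + k)) ⟩
      frac (N i * (suc i + suc k + 1)) (D * suc (i + k))
        ≡⟨ frac-cross (N i * (suc i + suc k + 1)) (D * suc (i + k)) (N (suc i)) D (cross i k) ⟩
      F (suc i)                                     ∎
      where open ≡-Reasoning

  ∏column-[i+j]/[i+j-1] : ∀ k →
    ∏column (λ i j → frac (i + j) (i + j ∸ 1)) (suc k) ≡ frac (1 + suc k + k) (suc k)
  ∏column-[i+j]/[i+j-1] k =
    telescope (λ i → frac (i + suc k) (i + suc k ∸ 1)) F
              (frac-cross (suc k) (suc k) 1 1 (*-comm (suc k) 1)) step (suc k)
    where
    F : ℕ → ℚ
    F m = frac (1 + m + k) (suc k)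
    cross : ∀ i k → (1 + i + k) * (suc i + suc k) * suc k ≡ (1 + suc i + k) * (suc k * suc (i + k))
    cross = solve-∀
    step : ∀ i → F i *ℚ frac (suc i + suc k) (suc i + suc k ∸ 1) ≡ F (suc i)
    step i = begin
      F i *ℚ frac (suc i + suc k) (i + suc k)   ≡⟨ cong (λ d → F i *ℚ frac (suc i + suc k) d) (+-suc i k) ⟩
      F i *ℚ frac (suc i + suc k) (suc (i + k)) ≡⟨ frac-* (1 + i + k) (suc k) (suc i + suc k) (suc (i + k)) ⟩
      frac ((1 + i + k) * (suc i + suc k)) (suc k * suc (i + k))
        ≡⟨ frac-cross ((1 + i + k) * (suc i + suc k)) (suc k * suc (i + k))
                      (1 + suc i + k) (suc k) (cross i k) ⟩
      F (suc i)                                 ∎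
      where open ≡-Reasoning

  ∏≤[i+j]/[i+j-1]≡2^n : ∀ n → ∏≤ n (λ i j → frac (i + j) (i + j ∸ 1)) ≡ frac (2 ^ n) 1
  ∏≤[i+j]/[i+j-1]≡2^n n = trans (∏≤-columns n _) (telescope _ (λ m → frac (2 ^ m) 1) refl step n)
    where
    cross : ∀ x k → x * (1 + suc k + k) * 1 ≡ (2 * x) * (1 * suc k)
    cross = solve-∀
    step : ∀ k → frac (2 ^ k) 1 *ℚ ∏column (λ i j → frac (i + j) (i + j ∸ 1)) (suc k) ≡ frac (2 ^ suc k) 1
    step k = begin
      frac (2 ^ k) 1 *ℚ ∏column (λ i j → frac (i + j) (i + j ∸ 1)) (suc k)
        ≡⟨ cong (frac (2 ^ k) 1 *ℚ_) (∏column-[i+j]/[i+j-1] k) ⟩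
      frac (2 ^ k) 1 *ℚ frac (1 + suc k + k) (suc k)
        ≡⟨ frac-* (2 ^ k) 1 (1 + suc k + k) (suc k) ⟩
      frac (2 ^ k * (1 + suc k + k)) (1 * suc k)
        ≡⟨ frac-cross (2 ^ k * (1 + suc k + k)) (1 * suc k) (2 ^ suc k) 1 (cross (2 ^ k) k) ⟩
      frac (2 ^ suc k) 1 ∎
      where open ≡-Reasoning

  ∏≤[i+j+1]/[i+j-1]≡[2n+1]C[n+1] : ∀ n →
    ∏≤ n (λ i j → frac (i + j + 1) (i + j ∸ 1)) ≡ frac (suc (n + n) C suc n) 1
  ∏≤[i+j+1]/[i+j-1]≡[2n+1]C[n+1] n = trans (∏≤-columns n _) (telescope _ (λ m → frac (b m) 1) refl step n)
    where
    b : ℕ → ℕ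
    b m = suc (m + m) C suc m
    N D : ℕ → ℕ
    N k = (2 + suc k + k) * (1 + suc k + k)
    D k = (2 + k) * (1 + k)
    N≡ : ∀ k → (2 + suc k + k) * (1 + suc k + k) ≡ suc (suc k + suc k) * (suc k + suc k)
    N≡ = solve-∀
    cross : ∀ k → b k * N k * 1 ≡ b (suc k) * (1 * D k)
    cross k = begin
      b k * N k * 1                               ≡⟨ *-identityʳ _ ⟩
      b k * N k                                   ≡⟨ cong (b k *_) (N≡ k) ⟩
      b k * (suc (suc k + suc k) * (suc k + suc k)) ≡⟨ [2n+3]C[n+2]-step k ⟨
      b (suc k) * D k                             ≡⟨ cong (b (suc k) *_) (*-identityˡ (D k)) ⟨
      b (suc k) * (1 * D k)                       ∎
      where open ≡-Reasoning
    step : ∀ k → frac (b k) 1 *ℚ ∏column (λ i j → frac (i + j + 1) (i + j ∸ 1)) (suc k) ≡ frac (b (suc k)) 1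
    step k = begin
      frac (b k) 1 *ℚ ∏column (λ i j → frac (i + j + 1) (i + j ∸ 1)) (suc k)
        ≡⟨ cong (frac (b k) 1 *ℚ_) (∏column-[i+j+1]/[i+j-1] k) ⟩
      frac (b k) 1 *ℚ frac (N k) (D k)            ≡⟨ frac-* (b k) 1 (N k) (D k) ⟩
      frac (b k * N k) (1 * D k)
        ≡⟨ frac-cross (b k * N k) (1 * D k) (b (suc k)) 1 (cross k) ⟩
      frac (b (suc k)) 1                          ∎
      where open ≡-Reasoning

  frac-identity : ∀ x y t p → x + t ≡ y * y + p →
    frac x 1 ≡ frac y 1 *ℚ frac y 1 -ℚ (frac t 1 -ℚ frac p 1)
  frac-identity x y t p x+t≡y²+p = begin
    frac x 1                                      ≡⟨ cancel (frac x 1) (frac t 1) ⟨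
    (frac x 1 +ℚ frac t 1) -ℚ frac t 1            ≡⟨ cong (_-ℚ frac t 1) (frac-+ x t) ⟩
    frac (x + t) 1 -ℚ frac t 1                    ≡⟨ cong (λ z → frac z 1 -ℚ frac t 1) x+t≡y²+p ⟩
    frac (y * y + p) 1 -ℚ frac t 1                ≡⟨ cong (_-ℚ frac t 1) (frac-+ (y * y) p) ⟨
    (frac (y * y) 1 +ℚ frac p 1) -ℚ frac t 1      ≡⟨ cong (λ z → (z +ℚ frac p 1) -ℚ frac t 1) (frac-* y 1 y 1) ⟨
    (frac y 1 *ℚ frac y 1 +ℚ frac p 1) -ℚ frac t 1 ≡⟨ regroup (frac y 1 *ℚ frac y 1) (frac t 1) (frac p 1) ⟩
    frac y 1 *ℚ frac y 1 -ℚ (frac t 1 -ℚ frac p 1) ∎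
    where
    open ≡-Reasoning
    open +-*-Solver
    cancel : ∀ x t → (x +ℚ t) -ℚ t ≡ x
    cancel = solve 2 (λ x t → (x :+ t) :- t := x) refl
    regroup : ∀ y t p → (y +ℚ p) -ℚ t ≡ y -ℚ (t -ℚ p)
    regroup = solve 3 (λ y t p → (y :+ p) :- t := y :- (t :- p)) refl

open import Data.Nat using (ℕ; suc; _+_; _∸_; _^_; NonZero)
open import Data.Fin using (Fin)
open import Data.Product using (Σ; _×_; _,_)
open import Function.Bundles using (_↔_)
open import Relation.Binary.PropositionalEquality
open import Data.Integer using (+_)
open import Data.Rational using (ℚ; _/_; _*_; _-_)
open import Data.Nat.Properties using (m+n∸n≡m)
open import Function.Properties.Inverse using (↔-trans)
open ColumnCounting

proposition2p4p9 : (n : ℕ) → .{{_ : NonZero n}} →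
    Σ ℕ (λ κ₁ → Σ ℕ (λ κ₂ →
      (Col n ↔ Fin κ₁) × (Cell2 n ↔ Fin κ₂) × (κ₁ ≡ 2 ^ n ∸ 1)
      × ((+ κ₂) / 1 ≡ ((+ κ₁) / 1) * ((+ κ₁) / 1)
            - (∏≤ n (λ i j → frac (i + j + 1) (i + j ∸ 1))
               - ∏≤ n (λ i j → frac (i + j) (i + j ∸ 1))))))
proposition2p4p9 n = nonemptyCount n , cellCount n ,
  ↔-trans Col↔nonempty-Subset (Σ-T↔Fin-∑ nonemptyᵇ) ,
  ↔-trans Cell2↔cell-Subset² (Σ₂-T↔Fin-∑₂ cellᵇ) ,
  trans (sym (m+n∸n≡m (nonemptyCount n) 1)) (cong (_∸ 1) (nonemptyCount+1 n)) ,
  trans (frac-identity (cellCount n) (nonemptyCount n) (tableauCount n) (2 ^ n) (cellCount+tableauCount n))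
        (cong₂ (λ P Q → frac (nonemptyCount n) 1 * frac (nonemptyCount n) 1 - (P - Q))
               (trans (cong (λ t → frac t 1) (tableauCount≡[2n+1]C[n+1] n))
                      (sym (∏≤[i+j+1]/[i+j-1]≡[2n+1]C[n+1] n)))
               (sym (∏≤[i+j]/[i+j-1]≡2^n n)))
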